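{- For a relation $Q \subseteq X \times Y$ between Kripke frames $(X,R)$ and $(Y,S)$, the following are equivalent: (i) $Q$ is a simulation; (ii) $A \mathrel{\mathrm{Low}(Q)} B$ implies $\Diamond^{ - } A \mathrel{\mathrm{Low}(Q)} \Diamond^{ - } B$ for all $A \subseteq X$, $B \subseteq Y$; (iii) $A \mathrel{\mathrm{Low}(Q)} \Box B$ implies $\Diamond^{ - } A \mathrel{\mathrm{Low}(Q)} B$ for all $A \subseteq X$, $B \subseteq Y$.
   Context: $Q$ is a simulation if $x \mathrel{Q} y$ and $x \mathrel{R} x'$ imply there is $y'$ with $y \mathrel{S} y'$ and $x' \mathrel{Q} y'$. $\mathrm{Low}(Q) \subseteq \mathcal{P}(X)\times\mathcal{P}(Y)$ is defined by $A \mathrel{\mathrm{Low}(Q)} B$ iff $\forall a \in A.\ \exists b\in B.\ a \mathrel{Q} b$. On $\mathcal{P}(X)$, $\Diamond^{ - }(A) = \{w \mid \exists v \in A.\ v \mathrel{R} w\}$ and $\Box(A) = \{w \mid \forall v.\ w \mathrel{R} v \Rightarrow v \in A\}$ (so $\Diamond^{ - }$ is left adjoint to $\Box$); similarly on $\mathcal{P}(Y)$ using $S$. -}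

module Defs where

open import Level using (Level; _⊔_)
open import Data.Product using (Σ; _×_; _,_; ∃-syntax)
open import Relation.Binary.Core using (REL; Rel)
open import Relation.Unary using (Pred; _∈_)

IsSimulation : ∀ {a b ℓ} {X : Set a} {Y : Set b}
  → Rel X ℓ → Rel Y ℓ → REL X Y ℓ → Set (a ⊔ b ⊔ ℓ)
IsSimulation {X = X} {Y} R S Q =
  ∀ {x : X} {y : Y} {x' : X} → Q x y → R x x' → ∃[ y' ] (S y y' × Q x' y')

Low : ∀ {a b ℓ} {X : Set a} {Y : Set b}
  → REL X Y ℓ → Pred X ℓ → Pred Y ℓ → Set (a ⊔ b ⊔ ℓ)
Low {X = X} {Y} Q A B = ∀ (x : X) → x ∈ A → ∃[ y ] (y ∈ B × Q x y)

◇⁻ : ∀ {a ℓ} {X : Set a} → Rel X ℓ → Pred X ℓ → Pred X (a ⊔ ℓ)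
◇⁻ {X = X} R A w = ∃[ v ] (v ∈ A × R v w)

□ : ∀ {a ℓ} {X : Set a} → Rel X ℓ → Pred X ℓ → Pred X (a ⊔ ℓ)
□ {X = X} R A w = ∀ (v : X) → R w v → v ∈ A

{-# OPTIONS --safe #-}
module Submission where

open import Defs
open import Level using (Level)
open import Data.Product using (_×_; _,_)
open import Relation.Binary.PropositionalEquality using (refl)
open import Relation.Binary.Core using (REL; Rel)
open import Relation.Unary using (Pred; _∈_; _⊆_; ｛_｝)

-- (i) ⇒ (ii) is the simulation property read pointwise; (ii) ⇒ (iii) applies (ii)
-- to □ B and uses the counit ◇⁻ □ B ⊆ B of the adjunction ◇⁻ ⊣ □; (iii) ⇒ (i)
-- applies (iii) to A = {x} and B = ◇⁻ {y}, the successors of y, which is possible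
-- because of the unit y ∈ □ ◇⁻ {y}.

private
  variable
    ℓ : Level

◇⁻-□-counit : {X : Set ℓ} {R : Rel X ℓ} {A : Pred X ℓ} → ◇⁻ R (□ R A) ⊆ A
◇⁻-□-counit (_ , v∈□A , Rvw) = v∈□A _ Rvw

□-◇⁻-unit : {X : Set ℓ} {R : Rel X ℓ} {A : Pred X ℓ} → A ⊆ □ R (◇⁻ R A)
□-◇⁻-unit w∈A v Rwv = _ , w∈A , Rwv

Low-monoʳ : {X Y : Set ℓ} {Q : REL X Y ℓ} {A : Pred X ℓ} {B B′ : Pred Y ℓ}
  → B ⊆ B′ → Low Q A B → Low Q A B′
Low-monoʳ B⊆B′ low x x∈A with low x x∈A
... | y , y∈B , Qxy = y , B⊆B′ y∈B , Qxy

Low-｛｝ : {X Y : Set ℓ} {Q : REL X Y ℓ} {B : Pred Y ℓ} {x : X} {y : Y}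
  → Q x y → y ∈ B → Low Q ｛ x ｝ B
Low-｛｝ Qxy y∈B _ refl = _ , y∈B , Qxy

module _ {X Y : Set ℓ} (R : Rel X ℓ) (S : Rel Y ℓ) (Q : REL X Y ℓ) where

  simulation⇒◇⁻-preserves-Low : IsSimulation R S Q
    → ∀ (A : Pred X ℓ) (B : Pred Y ℓ) → Low Q A B → Low Q (◇⁻ R A) (◇⁻ S B)
  simulation⇒◇⁻-preserves-Low sim A B low w (v , v∈A , Rvw) with low v v∈A
  ... | b , b∈B , Qvb with sim Qvb Rvw
  ... | y , Sby , Qwy = y , (b , b∈B , Sby) , Qwy

  ◇⁻-preserves-Low⇒Low-□-transpose
    : (∀ (A : Pred X ℓ) (B : Pred Y ℓ) → Low Q A B → Low Q (◇⁻ R A) (◇⁻ S B))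
    → ∀ (A : Pred X ℓ) (B : Pred Y ℓ) → Low Q A (□ S B) → Low Q (◇⁻ R A) B
  ◇⁻-preserves-Low⇒Low-□-transpose preserves A B low =
    Low-monoʳ ◇⁻-□-counit (preserves A (□ S B) low)

  Low-□-transpose⇒simulation
    : (∀ (A : Pred X ℓ) (B : Pred Y ℓ) → Low Q A (□ S B) → Low Q (◇⁻ R A) B)
    → IsSimulation R S Q
  Low-□-transpose⇒simulation transpose {x} {y} {x′} Qxy Rxx′
    with transpose ｛ x ｝ (◇⁻ S ｛ y ｝) (Low-｛｝ Qxy (□-◇⁻-unit refl)) x′ (x , refl , Rxx′)
  ... | y′ , (_ , refl , Syy′) , Qx′y′ = y′ , Syy′ , Qx′y′

mainTheorem12 : ∀ {ℓ : Level} {X Y : Set ℓ} (R : Rel X ℓ) (S : Rel Y ℓ) (Q : REL X Y ℓ)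
    → (IsSimulation R S Q → ∀ (A : Pred X ℓ) (B : Pred Y ℓ) → Low Q A B → Low Q (◇⁻ R A) (◇⁻ S B))
    × ((∀ (A : Pred X ℓ) (B : Pred Y ℓ) → Low Q A B → Low Q (◇⁻ R A) (◇⁻ S B)) → (∀ (A : Pred X ℓ) (B : Pred Y ℓ) → Low Q A (□ S B) → Low Q (◇⁻ R A) B))
    × ((∀ (A : Pred X ℓ) (B : Pred Y ℓ) → Low Q A (□ S B) → Low Q (◇⁻ R A) B) → IsSimulation R S Q)
mainTheorem12 R S Q =
  simulation⇒◇⁻-preserves-Low R S Q ,
  ◇⁻-preserves-Low⇒Low-□-transpose R S Q ,
  Low-□-transpose⇒simulation R S Q
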